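{- For $n\geq 6$, $$\left|\mathcal{A}_n(1324,1423;213)\big|_2^3\right|=a_{n-2}(1324,1423;213).$$
   Context: A permutation $\pi$ of $[n]=\{1,\dots,n\}$ is cyclic if it consists of a single $n$-cycle. Its one-line notation is $\pi_1\pi_2\cdots\pi_n$ with $\pi_i=\pi(i)$. Its standard cycle form is $(c_1,c_2,\dots,c_n)$ with $c_1=1$ and $c_{i+1}=\pi(c_i)$ for $1\le i<n$. A sequence $w_1\cdots w_n$ of distinct integers contains a pattern $\sigma=\sigma_1\cdots\sigma_k\in S_k$ if there are indices $i_1<\dots<i_k$ with $w_{i_s}>w_{i_t}$ iff $\sigma_s>\sigma_t$ for all $s<t$; otherwise it avoids $\sigma$. $\mathcal{A}_n(1324,1423;213)$ is the set of cyclic permutations of $[n]$ whose one-line notation avoids $1324$ and $1423$ and whose standard cycle form $c_1\cdots c_n$, read as a sequence, avoids $213$; $a_n(1324,1423;213)$ is its cardinality. For $2\le j\le n$, $\mathcal{A}_n(1324,1423;213)\big|_2^j$ is the set of its elements whose standard cycle form has $c_j=2$. -}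

module Defs where

open import Data.Bool using (Bool; true; false; _∧_; _∨_; not; if_then_else_)
open import Data.Nat using (ℕ; zero; suc; _<ᵇ_; _≡ᵇ_)
open import Data.Fin using (Fin; toℕ)
import Data.Vec
import Data.Fin
open import Data.Vec using (Vec; lookup; toList)
open import Data.List using (List; []; _∷_; map; length; filter; concatMap; allFin; _++_)
open import Data.Bool.ListAction using (and; or)
import Data.List as L
open import Relation.Nullary.Decidable using (does)
open import Relation.Binary.PropositionalEquality using (_≡_)
open import Data.Bool using (T)
open import Data.Bool.Properties using (T?)

-- Permutations of [n] are given in one-line notation as a vector
-- π : Vec (Fin n) n, where position i (0-based) holds π(i+1)-1.
-- All sequences below are lists of natural numbers with the paper's
-- 1-based values (entry k means the element k of [n]).

allVecs : (k n : ℕ) → List (Vec (Fin n) k)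
allVecs zero    n = Data.Vec.[] ∷ []
allVecs (suc k) n = concatMap (λ i → map (i Data.Vec.∷_) (allVecs k n)) (allFin n)

oneLine : ∀ {n} → Vec (Fin n) n → List ℕ
oneLine π = map (λ i → suc (toℕ i)) (toList π)

orbit : ∀ {n} → Vec (Fin n) n → ℕ → Fin n → List (Fin n)
orbit π zero    x = []
orbit π (suc k) x = x ∷ orbit π k (lookup π x)

cycleForm : ∀ {n} → Vec (Fin n) n → List ℕ
cycleForm {zero}  π = []
cycleForm {suc n} π = map (λ i → suc (toℕ i)) (orbit π (suc n) Data.Fin.zero)

memᵇ : ℕ → List ℕ → Bool
memᵇ x []       = false
memᵇ x (y ∷ ys) = (x ≡ᵇ y) ∨ memᵇ x ys

distinctᵇ : List ℕ → Bool
distinctᵇ []       = true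
distinctᵇ (x ∷ xs) = not (memᵇ x xs) ∧ distinctᵇ xs

-- π is a permutation (bijection of [n]) and consists of a single n-cycle:
-- the orbit c_1,…,c_n of 1 consists of n distinct elements.
isCyclicᵇ : ∀ {n} → Vec (Fin n) n → Bool
isCyclicᵇ π = distinctᵇ (oneLine π) ∧ distinctᵇ (cycleForm π)

subseqs : ℕ → List ℕ → List (List ℕ)
subseqs zero    xs       = [] ∷ []
subseqs (suc k) []       = []
subseqs (suc k) (x ∷ xs) = map (x ∷_) (subseqs k xs) ++ subseqs (suc k) xs

_>ᵇ_ : ℕ → ℕ → Bool
a >ᵇ b = b <ᵇ a

_⇔ᵇ_ : Bool → Bool → Bool
true  ⇔ᵇ b = b
false ⇔ᵇ b = not b

orderIsoᵇ : List ℕ → List ℕ → Bool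
orderIsoᵇ []       []       = true
orderIsoᵇ (w ∷ ws) (s ∷ ss) =
  and (L.zipWith (λ w' s' → (w >ᵇ w') ⇔ᵇ (s >ᵇ s')) ws ss) ∧ orderIsoᵇ ws ss
orderIsoᵇ _        _        = false

containsᵇ : List ℕ → List ℕ → Bool
containsᵇ w σ = or (map (λ u → orderIsoᵇ u σ) (subseqs (length σ) w))

avoidsᵇ : List ℕ → List ℕ → Bool
avoidsᵇ w σ = not (containsᵇ w σ)

p1324 p1423 p213 : List ℕ
p1324 = 1 ∷ 3 ∷ 2 ∷ 4 ∷ []
p1423 = 1 ∷ 4 ∷ 2 ∷ 3 ∷ []
p213  = 2 ∷ 1 ∷ 3 ∷ []

inAᵇ : ∀ {n} → Vec (Fin n) n → Bool
inAᵇ π = isCyclicᵇ π ∧ avoidsᵇ (oneLine π) p1324 ∧ avoidsᵇ (oneLine π) p1423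
         ∧ avoidsᵇ (cycleForm π) p213

-- j-th entry (1-based) of a list, equal to v?
entryIsᵇ : ℕ → ℕ → List ℕ → Bool
entryIsᵇ j v []       = false
entryIsᵇ zero v (x ∷ xs) = false
entryIsᵇ (suc zero) v (x ∷ xs) = x ≡ᵇ v
entryIsᵇ (suc (suc j)) v (x ∷ xs) = entryIsᵇ (suc j) v xs

-- 𝒜_n(1324,1423;213)|_2^j : elements whose standard cycle form has c_j = 2
inARestrᵇ : ∀ {n} → ℕ → Vec (Fin n) n → Bool
inARestrᵇ j π = inAᵇ π ∧ entryIsᵇ j 2 (cycleForm π)

a : ℕ → ℕ
a n = length (filter (λ π → T? (inAᵇ π)) (allVecs n n))

aRestr : ℕ → ℕ → ℕ
aRestr n j = length (filter (λ π → T? (inARestrᵇ j π)) (allVecs n n))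

{-# OPTIONS --safe #-}
module Submission where

-- Let π ∈ 𝒜ₙ(1324,1423;213) have cycle form 1, c₂, 2, …. If c₂ < n, then n occurs later in the
-- cycle and c₂, 2, n is an occurrence of 213; hence π(1) = n and π(n) = 2. Removing the first
-- and last entries of π and the values n and 2 leaves a cyclic permutation σ of [n − 2]:
-- π = (n, σ̂, 2), where σ̂ is σ with every value ≥ 2 raised by one, and the cycle form of π is
-- 1, n followed by the cycle form of σ raised by one. Thus σ ↦ π is a
-- bijection 𝒜ₙ₋₂(1324,1423;213) → 𝒜ₙ(1324,1423;213)|₂³, for every n ≥ 3.

open import Defs
open import Data.Bool using (Bool; true; false; T; not; _∧_; _∨_)
open import Data.Bool.Properties using (T?; T-∧; ∧-identityʳ)
open import Data.Bool.ListAction using (and)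
open import Data.Fin as Fin using (Fin; toℕ; fromℕ; inject₁; lower₁; punchIn)
  renaming (zero to fzero; suc to fsuc)
import Data.Fin.Properties as Fin
open import Data.List
  using (List; []; _∷_; _++_; [_]; map; length; filter; zipWith; allFin; concatMap; cartesianProductWith)
open import Data.List.Properties using (length-++; length-++-sucʳ; length-map; length-tabulate; map-++; map-∘; map-cong)
open import Data.List.Membership.Propositional using (_∈_; _∉_; find; lose)
open import Data.List.Membership.Propositional.Properties
  using (∈-map⁺; ∈-map⁻; ∈-++⁺ˡ; ∈-++⁺ʳ; ∈-++⁻; ∈-∃++; ∈-allFin; ∈-cartesianProductWith⁺;
         ∈-filter⁺; ∈-filter⁻)
open import Data.List.Membership.Propositional.Properties.WithK using (unique∧set⇒bag)
import Data.List.Membership.DecPropositional as DecMembership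
open import Data.List.Relation.Binary.BagAndSetEquality using (_∼[_]_; set; ∼bag⇒↭)
open import Data.List.Relation.Binary.Permutation.Propositional.Properties using (↭-length)
open import Data.List.Relation.Binary.Pointwise using (Pointwise; []; _∷_)
open import Data.List.Relation.Binary.Sublist.Propositional using (_⊆_; []; _∷_; _∷ʳ_; from∈)
import Data.List.Relation.Binary.Sublist.Propositional.Properties as Sublist
import Data.List.Relation.Binary.Subset.Propositional as Subset
open import Data.List.Relation.Unary.All as All using (All; []; _∷_)
import Data.List.Relation.Unary.All.Properties as All
open import Data.List.Relation.Unary.Any using (here; there)
open import Data.List.Relation.Unary.Any.Properties using (any⁺; any⁻)
open import Data.List.Relation.Unary.Unique.Propositional using (Unique; []; _∷_)
import Data.List.Relation.Unary.Unique.Propositional.Properties as Unique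
open import Data.Nat using (ℕ; zero; suc; _+_; _∸_; _≤_; _<_; _<ᵇ_; _≡ᵇ_; z≤n; s≤s)
import Data.Nat.Properties as ℕ
open import Data.Product using (∃-syntax; _×_; _,_; proj₁; proj₂)
open import Data.Sum using (_⊎_; inj₁; inj₂)
open import Data.Vec using (Vec; lookup; toList)
  renaming ([] to []ᵛ; _∷_ to _∷ᵛ_; _∷ʳ_ to _∷ʳᵛ_)
import Data.Vec as Vec
import Data.Vec.Properties as Vec
open import Function using (_∘_; _⇔_; mk⇔; Equivalence; Injective)
open import Relation.Binary.PropositionalEquality
  using (_≡_; _≢_; refl; sym; trans; cong; cong₂; subst; subst₂; module ≡-Reasoning)
open import Relation.Nullary using (¬_; Dec; does; yes; no; contradiction)
open import Relation.Nullary.Decidable using (dec-true; dec-false; does-⇔)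

private
  variable
    A : Set
    k m n : ℕ

allVecs-suc : ∀ k n → allVecs (suc k) n ≡ cartesianProductWith _∷ᵛ_ (allFin n) (allVecs k n)
allVecs-suc k n = go (allFin n)
  where
  go : ∀ is → concatMap (λ i → map (i ∷ᵛ_) (allVecs k n)) is
            ≡ cartesianProductWith _∷ᵛ_ is (allVecs k n)
  go []       = refl
  go (i ∷ is) = cong (map (i ∷ᵛ_) (allVecs k n) ++_) (go is)

∈-allVecs : (v : Vec (Fin n) k) → v ∈ allVecs k n
∈-allVecs []ᵛ                   = here refl
∈-allVecs {n} {suc k} (i ∷ᵛ v) =
  subst (i ∷ᵛ v ∈_) (sym (allVecs-suc k n)) (∈-cartesianProductWith⁺ _∷ᵛ_ (∈-allFin i) (∈-allVecs v))

allVecs-unique : ∀ k n → Unique (allVecs k n)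
allVecs-unique zero    n = [] ∷ []
allVecs-unique (suc k) n = subst Unique (sym (allVecs-suc k n))
  (Unique.cartesianProductWith⁺ _∷ᵛ_ Vec.∷-injective (Unique.allFin⁺ n) (allVecs-unique k n))

unique∧set⇒length≡ : {xs ys : List A} → Unique xs → Unique ys → xs ∼[ set ] ys →
                     length xs ≡ length ys
unique∧set⇒length≡ uxs uys xs∼ys = ↭-length (∼bag⇒↭ (unique∧set⇒bag uxs uys xs∼ys))

unique⇒length≤ : {xs ys : List A} → Unique xs → xs Subset.⊆ ys → length xs ≤ length ys
unique⇒length≤ {xs = []}     _          _     = z≤n
unique⇒length≤ {xs = x ∷ xs} (x∉ ∷ uxs) xs⊆ys with ys₁ , ys₂ , refl ← ∈-∃++ (xs⊆ys (here refl)) =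
  subst (suc (length xs) ≤_) (sym (length-++-sucʳ ys₁ x ys₂)) (s≤s (unique⇒length≤ uxs xs⊆ys₁++ys₂))
  where
  xs⊆ys₁++ys₂ : xs Subset.⊆ ys₁ ++ ys₂
  xs⊆ys₁++ys₂ z∈xs with ∈-++⁻ ys₁ (xs⊆ys (there z∈xs))
  ... | inj₁ z∈ys₁         = ∈-++⁺ˡ z∈ys₁
  ... | inj₂ (here refl)   = contradiction refl (All.lookup x∉ z∈xs)
  ... | inj₂ (there z∈ys₂) = ∈-++⁺ʳ ys₁ z∈ys₂

unique∧length≡n⇒∈ : {xs : List (Fin n)} → Unique xs → length xs ≡ n → ∀ y → y ∈ xs
unique∧length≡n⇒∈ {suc n} {xs} uxs len y with DecMembership._∈?_ Fin._≟_ y xs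
... | yes y∈xs = y∈xs
... | no  y∉xs =
  contradiction (subst₂ _≤_ len length-image (unique⇒length≤ uxs xs⊆image)) (ℕ.n≮n n)
  where
  length-image : length (map (punchIn y) (allFin n)) ≡ n
  length-image = trans (length-map (punchIn y) (allFin n)) (length-tabulate _)
  xs⊆image : xs Subset.⊆ map (punchIn y) (allFin n)
  xs⊆image {z} z∈xs = subst (_∈ _) (Fin.punchIn-punchOut y≢z) (∈-map⁺ (punchIn y) (∈-allFin _))
    where
    y≢z : y ≢ z
    y≢z refl = y∉xs z∈xs

T-injective : ∀ {a b} → (T a → T b) → (T b → T a) → a ≡ b
T-injective {false} {false} _ _ = refl
T-injective {false} {true}  _ f = contradiction (f _) λ ()
T-injective {true}  {false} f _ = contradiction (f _) λ ()
T-injective {true}  {true}  _ _ = refl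

T-not⇒¬T : ∀ {b} → T (not b) → ¬ T b
T-not⇒¬T {false} _ ()

open DecMembership ℕ._≟_ using (_∈?_)

memᵇ-does : ∀ x l → memᵇ x l ≡ does (x ∈? l)
memᵇ-does x []      = refl
memᵇ-does x (y ∷ l) = cong ((x ≡ᵇ y) ∨_) (memᵇ-does x l)

memᵇ-cong : ∀ {x y l l'} → x ∈ l ⇔ y ∈ l' → memᵇ x l ≡ memᵇ y l'
memᵇ-cong {x} {y} {l} {l'} x∈l⇔y∈l' =
  trans (memᵇ-does x l) (trans (does-⇔ x∈l⇔y∈l' (x ∈? l) (y ∈? l')) (sym (memᵇ-does y l')))

memᵇ-∈ : ∀ {x l} → x ∈ l → memᵇ x l ≡ true
memᵇ-∈ {x} {l} x∈l = trans (memᵇ-does x l) (dec-true (x ∈? l) x∈l)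

memᵇ-∉ : ∀ {x l} → x ∉ l → memᵇ x l ≡ false
memᵇ-∉ {x} {l} x∉l = trans (memᵇ-does x l) (dec-false (x ∈? l) x∉l)

distinctᵇ-map : ∀ {f} → Injective _≡_ _≡_ f → ∀ l → distinctᵇ (map f l) ≡ distinctᵇ l
distinctᵇ-map     f-inj []      = refl
distinctᵇ-map {f} f-inj (x ∷ l) =
  cong₂ (λ b b' → not b ∧ b') (memᵇ-cong (mk⇔ from (∈-map⁺ f))) (distinctᵇ-map f-inj l)
  where
  from : f x ∈ map f l → x ∈ l
  from fx∈ with y , y∈l , fx≡fy ← ∈-map⁻ f fx∈ = subst (_∈ l) (sym (f-inj fx≡fy)) y∈l

distinctᵇ-++-fresh : ∀ {y} l → y ∉ l → distinctᵇ (l ++ [ y ]) ≡ distinctᵇ l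
distinctᵇ-++-fresh     []      _   = refl
distinctᵇ-++-fresh {y} (x ∷ l) y∉ =
  cong₂ (λ b b' → not b ∧ b') (memᵇ-cong (mk⇔ to ∈-++⁺ˡ)) (distinctᵇ-++-fresh l (y∉ ∘ there))
  where
  to : x ∈ l ++ [ y ] → x ∈ l
  to x∈ with ∈-++⁻ l x∈
  ... | inj₁ x∈l         = x∈l
  ... | inj₂ (here refl) = contradiction (here refl) y∉

distinctᵇ⇒Unique : ∀ {l} → T (distinctᵇ l) → Unique l
distinctᵇ⇒Unique {[]}    _ = []
distinctᵇ⇒Unique {x ∷ l} t with fresh , rest ← Equivalence.to (T-∧ {not (memᵇ x l)}) t =
  All.¬Any⇒All¬ l (λ x∈l → subst (T ∘ not) (memᵇ-∈ x∈l) fresh) ∷ distinctᵇ⇒Unique rest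

-- Occurrences of patterns

-- a >ᵇ b is definitionally does (b <? a).
≤⇒>ᵇ≡false : ∀ {a b} → a ≤ b → (a >ᵇ b) ≡ false
≤⇒>ᵇ≡false {a} {b} a≤b = dec-false (b ℕ.<? a) (ℕ.≤⇒≯ a≤b)

<⇒>ᵇ≡true : ∀ {a b} → b < a → (a >ᵇ b) ≡ true
<⇒>ᵇ≡true {a} {b} b<a = dec-true (b ℕ.<? a) b<a

>ᵇ≡false⇒≤ : ∀ {a b} → (a >ᵇ b) ≡ false → a ≤ b
>ᵇ≡false⇒≤ {a} {b} eq = ℕ.≮⇒≥ (λ b<a → contradiction (trans (sym (dec-true (b ℕ.<? a) b<a)) eq) λ ())

∈-subseqs⁻ : ∀ {k u w} → u ∈ subseqs k w → u ⊆ w × length u ≡ k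
∈-subseqs⁻ {zero}  {w = w}     (here refl) = Sublist.[]⊆-universal w , refl
∈-subseqs⁻ {suc k} {w = x ∷ w} u∈ with ∈-++⁻ (map (x ∷_) (subseqs k w)) u∈
... | inj₂ u∈subseqs = let τ , len = ∈-subseqs⁻ u∈subseqs in x ∷ʳ τ , len
... | inj₁ u∈map with u , u∈subseqs , refl ← ∈-map⁻ (x ∷_) u∈map =
  let τ , len = ∈-subseqs⁻ u∈subseqs in refl ∷ τ , cong suc len

∈-subseqs⁺ : ∀ {u w : List ℕ} → u ⊆ w → u ∈ subseqs (length u) w
∈-subseqs⁺         []         = here refl
∈-subseqs⁺ {[]}    (_ ∷ʳ _)   = here refl
∈-subseqs⁺ {_ ∷ _} (_ ∷ʳ τ)   = ∈-++⁺ʳ _ (∈-subseqs⁺ τ)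
∈-subseqs⁺         (refl ∷ τ) = ∈-++⁺ˡ (∈-map⁺ _ (∈-subseqs⁺ τ))

Occurrence : List ℕ → List ℕ → Set
Occurrence p w = ∃[ u ] (u ⊆ w × length u ≡ length p × T (orderIsoᵇ u p))

T-containsᵇ : ∀ {w p} → T (containsᵇ w p) ⇔ Occurrence p w
T-containsᵇ {w} {p} = mk⇔ to from
  where
  to : T (containsᵇ w p) → Occurrence p w
  to t with u , u∈ , iso ← find (any⁻ _ _ t) = let τ , len = ∈-subseqs⁻ u∈ in u , τ , len , iso
  from : Occurrence p w → T (containsᵇ w p)
  from (u , τ , len , iso) = any⁺ _ (lose (subst (λ k → u ∈ subseqs k w) len (∈-subseqs⁺ τ)) iso)

containsᵇ-cong : ∀ {p w w'} → (Occurrence p w → Occurrence p w') → (Occurrence p w' → Occurrence p w) →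
                 containsᵇ w p ≡ containsᵇ w' p
containsᵇ-cong to from = T-injective (Equivalence.from T-containsᵇ ∘ to ∘ Equivalence.to T-containsᵇ)
                                     (Equivalence.from T-containsᵇ ∘ from ∘ Equivalence.to T-containsᵇ)

containsᵇ-∷ : ∀ {x w s ps} →
              (∀ {u} → u ⊆ w → length u ≡ length ps → ¬ T (orderIsoᵇ (x ∷ u) (s ∷ ps))) →
              containsᵇ (x ∷ w) (s ∷ ps) ≡ containsᵇ w (s ∷ ps)
containsᵇ-∷ {x} {w} {s} {ps} no-occurrence =
  containsᵇ-cong drop (λ (u , τ , len , iso) → u , x ∷ʳ τ , len , iso)
  where
  drop : Occurrence (s ∷ ps) (x ∷ w) → Occurrence (s ∷ ps) w
  drop (u     , _ ∷ʳ τ   , len , iso) = u , τ , len , iso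
  drop (_ ∷ u , refl ∷ τ , len , iso) = contradiction iso (no-occurrence τ (ℕ.suc-injective len))

⊆-++[]⁻ : ∀ {u w : List A} {y} → u ⊆ w ++ [ y ] → u ⊆ w ⊎ ∃[ u' ] (u ≡ u' ++ [ y ] × u' ⊆ w)
⊆-++[]⁻ {w = []}    (_ ∷ʳ [])   = inj₁ []
⊆-++[]⁻ {w = []}    (refl ∷ []) = inj₂ ([] , refl , [])
⊆-++[]⁻ {w = x ∷ w} (_ ∷ʳ τ) with ⊆-++[]⁻ τ
... | inj₁ σ               = inj₁ (x ∷ʳ σ)
... | inj₂ (u' , refl , σ) = inj₂ (u' , refl , x ∷ʳ σ)
⊆-++[]⁻ {w = x ∷ w} (refl ∷ τ) with ⊆-++[]⁻ τ
... | inj₁ σ               = inj₁ (refl ∷ σ)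
... | inj₂ (u' , refl , σ) = inj₂ (x ∷ u' , refl , refl ∷ σ)

containsᵇ-++[] : ∀ {w y s ps} →
                 (∀ {u} → u ⊆ w → length u ≡ length ps → ¬ T (orderIsoᵇ (u ++ [ y ]) (s ∷ ps))) →
                 containsᵇ (w ++ [ y ]) (s ∷ ps) ≡ containsᵇ w (s ∷ ps)
containsᵇ-++[] {w} {y} {s} {ps} no-occurrence =
  containsᵇ-cong (λ (u , τ , len , iso) → drop u len iso (⊆-++[]⁻ τ))
                 (λ (u , τ , len , iso) → u , Sublist.++⁺ʳ [ y ] τ , len , iso)
  where
  drop : ∀ u → length u ≡ length (s ∷ ps) → T (orderIsoᵇ u (s ∷ ps)) →
         u ⊆ w ⊎ ∃[ u' ] (u ≡ u' ++ [ y ] × u' ⊆ w) → Occurrence (s ∷ ps) w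
  drop u len iso (inj₁ σ)               = u , σ , len , iso
  drop _ len iso (inj₂ (u' , refl , σ)) =
    contradiction iso (no-occurrence σ (ℕ.suc-injective (trans (sym length-u'++[y]) len)))
    where
    length-u'++[y] : length (u' ++ [ y ]) ≡ suc (length u')
    length-u'++[y] = trans (length-++ u') (ℕ.+-comm _ 1)

⊆-map⁻ : ∀ {B : Set} {f : A → B} {u : List B} {w} → u ⊆ map f w → ∃[ u' ] (u ≡ map f u' × u' ⊆ w)
⊆-map⁻ {w = []}    []         = [] , refl , []
⊆-map⁻ {w = x ∷ w} (_ ∷ʳ τ)   with u' , refl , σ ← ⊆-map⁻ τ = u' , refl , x ∷ʳ σ
⊆-map⁻ {w = x ∷ w} (refl ∷ τ) with u' , refl , σ ← ⊆-map⁻ τ = x ∷ u' , refl , refl ∷ σ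

StrictlyMonotoneᵇ : (ℕ → ℕ) → Set
StrictlyMonotoneᵇ f = ∀ a b → (f a <ᵇ f b) ≡ (a <ᵇ b)

strictlyMonotone⇒injective : ∀ {f} → StrictlyMonotoneᵇ f → Injective _≡_ _≡_ f
strictlyMonotone⇒injective {f} mono {a} {b} fa≡fb =
  ℕ.≤-antisym (below a b fa≡fb) (below b a (sym fa≡fb))
  where
  irreflᵇ : ∀ n → (n <ᵇ n) ≡ false
  irreflᵇ zero    = refl
  irreflᵇ (suc n) = irreflᵇ n
  below : ∀ a b → f a ≡ f b → a ≤ b
  below a b eq = >ᵇ≡false⇒≤ (trans (sym (mono b a)) (trans (cong (f b <ᵇ_) eq) (irreflᵇ (f b))))

orderIsoᵇ-map : ∀ {f} → StrictlyMonotoneᵇ f → ∀ u p → orderIsoᵇ (map f u) p ≡ orderIsoᵇ u p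
orderIsoᵇ-map     mono []      _       = refl
orderIsoᵇ-map     mono (_ ∷ _) []      = refl
orderIsoᵇ-map {f} mono (v ∷ u) (s ∷ p) =
  cong₂ _∧_ (cong and (comparisons u p)) (orderIsoᵇ-map mono u p)
  where
  comparisons : ∀ u p → zipWith (λ v' s' → (f v >ᵇ v') ⇔ᵇ (s >ᵇ s')) (map f u) p
                      ≡ zipWith (λ v' s' → (v >ᵇ v') ⇔ᵇ (s >ᵇ s')) u p
  comparisons []       _        = refl
  comparisons (_ ∷ _)  []       = refl
  comparisons (v' ∷ u) (s' ∷ p) = cong₂ _∷_ (cong (_⇔ᵇ (s >ᵇ s')) (mono v' v)) (comparisons u p)

containsᵇ-map : ∀ f → StrictlyMonotoneᵇ f → ∀ w p → containsᵇ (map f w) p ≡ containsᵇ w p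
containsᵇ-map f mono w p = containsᵇ-cong to from
  where
  to : Occurrence p (map f w) → Occurrence p w
  to (_ , τ , len , iso) with u , refl , σ ← ⊆-map⁻ τ =
    u , σ , trans (sym (length-map f u)) len , subst T (orderIsoᵇ-map mono u p) iso
  from : Occurrence p w → Occurrence p (map f w)
  from (u , τ , len , iso) =
    map f u , Sublist.map⁺ f τ , trans (length-map f u) len , subst T (sym (orderIsoᵇ-map mono u p)) iso

⇔ᵇ⇒≡ : ∀ {a b} → T (a ⇔ᵇ b) → a ≡ b
⇔ᵇ⇒≡ {true}  {true}  _ = refl
⇔ᵇ⇒≡ {false} {false} _ = refl

orderIsoᵇ-∷⁻ : ∀ {x u s ps} → T (orderIsoᵇ (x ∷ u) (s ∷ ps)) →
               Pointwise (λ v t → (x >ᵇ v) ≡ (s >ᵇ t)) u ps × T (orderIsoᵇ u ps)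
orderIsoᵇ-∷⁻ {x} {u} {s} {ps} iso =
  let row , rest = Equivalence.to T-∧ iso in comparisons u ps row rest , rest
  where
  comparisons : ∀ u ps → T (and (zipWith (λ v t → (x >ᵇ v) ⇔ᵇ (s >ᵇ t)) u ps)) →
                T (orderIsoᵇ u ps) → Pointwise (λ v t → (x >ᵇ v) ≡ (s >ᵇ t)) u ps
  comparisons []      []       _   _    = []
  comparisons (_ ∷ u) (_ ∷ ps) row rest =
    let c , row' = Equivalence.to T-∧ row ; _ , rest' = Equivalence.to T-∧ rest
    in ⇔ᵇ⇒≡ c ∷ comparisons u ps row' rest'

-- An entry larger (b = true) or smaller (b = false) than every later entry can only play a
-- pattern letter with the same property.
containsᵇ-∷-extreme : ∀ {x w s ps} (b : Bool) →
                      All (λ v → (x >ᵇ v) ≡ b) w → ¬ All (λ t → (s >ᵇ t) ≡ b) ps →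
                      containsᵇ (x ∷ w) (s ∷ ps) ≡ containsᵇ w (s ∷ ps)
containsᵇ-∷-extreme {x} {w} {s} {ps} b x-extreme s-not-extreme = containsᵇ-∷ λ {u} τ _ iso →
  s-not-extreme (transfer (Sublist.All-resp-⊆ τ x-extreme) (proj₁ (orderIsoᵇ-∷⁻ {x} {u} {s} {ps} iso)))
  where
  transfer : ∀ {u ps} → All (λ v → (x >ᵇ v) ≡ b) u → Pointwise (λ v t → (x >ᵇ v) ≡ (s >ᵇ t)) u ps →
             All (λ t → (s >ᵇ t) ≡ b) ps
  transfer []             []             = []
  transfer (x>v≡b ∷ rest) (x>v≡s>t ∷ pw) = trans (sym x>v≡s>t) x>v≡b ∷ transfer rest pw

Unique-resp-⊆ : ∀ {u w : List A} → u ⊆ w → Unique w → Unique u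
Unique-resp-⊆ []         []         = []
Unique-resp-⊆ (_ ∷ʳ τ)   (_ ∷ uw)   = Unique-resp-⊆ τ uw
Unique-resp-⊆ (refl ∷ τ) (x∉w ∷ uw) = Sublist.All-resp-⊆ τ x∉w ∷ Unique-resp-⊆ τ uw

-- Such an occurrence would force 1 ≤ u₁ < u₃ < 2. As orderIsoᵇ only tests _>_, a tie u₁ = u₃
-- would match p₁ ≤ p₃, so the distinctness hypotheses are essential.
no-occurrence-ending-at-2 : ∀ {u₁ u₂ u₃ p₁ p₂ p₃ p₄} → 1 ≤ u₁ → u₁ ≢ u₃ → u₃ ≢ 2 →
                            p₁ ≤ p₃ → p₃ ≤ p₄ →
                            ¬ T (orderIsoᵇ (u₁ ∷ u₂ ∷ u₃ ∷ 2 ∷ []) (p₁ ∷ p₂ ∷ p₃ ∷ p₄ ∷ []))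
no-occurrence-ending-at-2 {u₁} {u₂} {u₃} {p₁} {p₂} {p₃} {p₄}
                          1≤u₁ u₁≢u₃ u₃≢2 p₁≤p₃ p₃≤p₄ iso
  with _ ∷ u₁∼u₃ ∷ _ ∷ [] , iso₂
       ← orderIsoᵇ-∷⁻ {u₁} {u₂ ∷ u₃ ∷ 2 ∷ []} {p₁} {p₂ ∷ p₃ ∷ p₄ ∷ []} iso
  with _ , iso₃ ← orderIsoᵇ-∷⁻ {u₂} {u₃ ∷ 2 ∷ []} {p₂} {p₃ ∷ p₄ ∷ []} iso₂
  with u₃∼2 ∷ [] , _ ← orderIsoᵇ-∷⁻ {u₃} {2 ∷ []} {p₃} {p₄ ∷ []} iso₃ =
  let u₁<u₃ = ℕ.≤∧≢⇒< (>ᵇ≡false⇒≤ (trans u₁∼u₃ (≤⇒>ᵇ≡false p₁≤p₃))) u₁≢u₃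
      u₃<2  = ℕ.≤∧≢⇒< (>ᵇ≡false⇒≤ (trans u₃∼2 (≤⇒>ᵇ≡false p₃≤p₄))) u₃≢2
  in ℕ.n≮n 1 (ℕ.<-≤-trans (ℕ.≤-<-trans 1≤u₁ u₁<u₃) (ℕ.≤-pred u₃<2))

containsᵇ-++[2] : ∀ {w p₁ p₂ p₃ p₄} → Unique w → All (λ v → 1 ≤ v × v ≢ 2) w →
                  p₁ ≤ p₃ → p₃ ≤ p₄ →
                  containsᵇ (w ++ [ 2 ]) (p₁ ∷ p₂ ∷ p₃ ∷ p₄ ∷ [])
                ≡ containsᵇ w (p₁ ∷ p₂ ∷ p₃ ∷ p₄ ∷ [])
containsᵇ-++[2] {w} {p₁} {p₂} {p₃} {p₄} uw bounds p₁≤p₃ p₃≤p₄ = containsᵇ-++[] no-occurrence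
  where
  no-occurrence : ∀ {u} → u ⊆ w → length u ≡ 3 →
                  ¬ T (orderIsoᵇ (u ++ [ 2 ]) (p₁ ∷ p₂ ∷ p₃ ∷ p₄ ∷ []))
  no-occurrence {_ ∷ _ ∷ _ ∷ []} τ refl
    with (1≤u₁ , _) ∷ _ ∷ (_ , u₃≢2) ∷ [] ← Sublist.All-resp-⊆ τ bounds
    with (_ ∷ u₁≢u₃ ∷ []) ∷ _ ← Unique-resp-⊆ τ uw
    = no-occurrence-ending-at-2 1≤u₁ u₁≢u₃ u₃≢2 p₁≤p₃ p₃≤p₄

occurrence-213 : ∀ {a b c w} → c < a → a < b → a ∷ c ∷ b ∷ [] ⊆ w → T (containsᵇ w p213)
occurrence-213 {a} {b} {c} c<a a<b τ = Equivalence.from T-containsᵇ (_ , τ , refl , iso)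
  where
  iso : T (orderIsoᵇ (a ∷ c ∷ b ∷ []) p213)
  iso rewrite <⇒>ᵇ≡true c<a
            | ≤⇒>ᵇ≡false (ℕ.<⇒≤ a<b)
            | ≤⇒>ᵇ≡false (ℕ.<⇒≤ (ℕ.<-trans c<a a<b)) = _

-- Pattern conditions after inflation

bump : ℕ → ℕ
bump zero          = zero
bump (suc zero)    = suc zero
bump (suc (suc v)) = suc (suc (suc v))

bump-monotone : StrictlyMonotoneᵇ bump
bump-monotone zero          zero          = refl
bump-monotone zero          (suc zero)    = refl
bump-monotone zero          (suc (suc _)) = refl
bump-monotone (suc zero)    zero          = refl
bump-monotone (suc zero)    (suc zero)    = refl
bump-monotone (suc zero)    (suc (suc _)) = refl
bump-monotone (suc (suc _)) zero          = refl
bump-monotone (suc (suc _)) (suc zero)    = refl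
bump-monotone (suc (suc _)) (suc (suc _)) = refl

InRange : ℕ → ℕ → Set
InRange m v = 1 ≤ v × v ≤ m

bump-range : ∀ {v} → InRange m v → 1 ≤ bump v × bump v ≢ 2 × bump v ≤ suc m
bump-range {v = suc zero}    (_ , _)   = s≤s z≤n , (λ ()) , s≤s z≤n
bump-range {v = suc (suc _)} (_ , v≤m) = s≤s z≤n , (λ ()) , s≤s v≤m

-- inAᵇ π unfolds to admissibleᵇ (oneLine π) (cycleForm π).
admissibleᵇ : List ℕ → List ℕ → Bool
admissibleᵇ o c = (distinctᵇ o ∧ distinctᵇ c) ∧ avoidsᵇ o p1324 ∧ avoidsᵇ o p1423 ∧ avoidsᵇ c p213

distinctᵇ-oneLine-inflated : ∀ {o} → 1 ≤ m → All (InRange m) o →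
                             distinctᵇ ((2 + m) ∷ (map bump o ++ [ 2 ])) ≡ distinctᵇ o
distinctᵇ-oneLine-inflated {m} {o} 1≤m o-range =
  trans (cong (λ b → not b ∧ distinctᵇ (map bump o ++ [ 2 ])) (memᵇ-∉ (All.All¬⇒¬Any max-fresh)))
        (trans (distinctᵇ-++-fresh (map bump o) (All.All¬⇒¬Any 2-fresh))
               (distinctᵇ-map (strictlyMonotone⇒injective bump-monotone) o))
  where
  max-fresh : All (2 + m ≢_) (map bump o ++ [ 2 ])
  max-fresh = All.++⁺ (All.map⁺ (All.map (λ r → ℕ.>⇒≢ (s≤s (proj₂ (proj₂ (bump-range r))))) o-range))
                      (ℕ.>⇒≢ (s≤s (s≤s 1≤m)) ∷ [])
  2-fresh : All (2 ≢_) (map bump o)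
  2-fresh = All.map⁺ (All.map (λ r → proj₁ (proj₂ (bump-range r)) ∘ sym) o-range)

distinctᵇ-cycle-inflated : ∀ {c} → All (InRange m) c → distinctᵇ (1 ∷ (2 + m) ∷ map suc c) ≡ distinctᵇ c
distinctᵇ-cycle-inflated {m} {c} c-range =
  trans (cong₂ (λ b b' → not b ∧ not b' ∧ distinctᵇ (map suc c))
               (memᵇ-∉ (All.All¬⇒¬Any 1-fresh)) (memᵇ-∉ (All.All¬⇒¬Any max-fresh)))
        (distinctᵇ-map ℕ.suc-injective c)
  where
  1-fresh : All (1 ≢_) ((2 + m) ∷ map suc c)
  1-fresh = (λ ()) ∷ All.map⁺ (All.map (λ r → ℕ.<⇒≢ (s≤s (proj₁ r))) c-range)
  max-fresh : All (2 + m ≢_) (map suc c)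
  max-fresh = All.map⁺ (All.map (λ r → ℕ.>⇒≢ (s≤s (s≤s (proj₂ r)))) c-range)

containsᵇ-oneLine-inflated : ∀ {o p₁ p₂ p₃ p₄} → 1 ≤ m → All (InRange m) o → Unique o →
  p₁ ≤ p₂ → p₁ ≤ p₃ → p₃ ≤ p₄ →
  containsᵇ ((2 + m) ∷ (map bump o ++ [ 2 ])) (p₁ ∷ p₂ ∷ p₃ ∷ p₄ ∷ [])
  ≡ containsᵇ o (p₁ ∷ p₂ ∷ p₃ ∷ p₄ ∷ [])
containsᵇ-oneLine-inflated {m} {o} {p₁} {p₂} {p₃} {p₄} 1≤m o-range o-unique p₁≤p₂ p₁≤p₃ p₃≤p₄ =
  trans (containsᵇ-∷-extreme true maximal λ { (p₁>p₂ ∷ _) → contradiction (trans (sym p₁>p₂) p₁≯p₂) λ () })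
  (trans (containsᵇ-++[2] bumped-unique bumped p₁≤p₃ p₃≤p₄)
         (containsᵇ-map bump bump-monotone o (p₁ ∷ p₂ ∷ p₃ ∷ p₄ ∷ [])))
  where
  p₁≯p₂ : (p₁ >ᵇ p₂) ≡ false
  p₁≯p₂ = ≤⇒>ᵇ≡false p₁≤p₂
  bumped-unique : Unique (map bump o)
  bumped-unique = Unique.map⁺ (strictlyMonotone⇒injective bump-monotone) o-unique
  maximal : All (λ v → ((2 + m) >ᵇ v) ≡ true) (map bump o ++ [ 2 ])
  maximal = All.++⁺ (All.map⁺ (All.map (λ r → <⇒>ᵇ≡true (s≤s (proj₂ (proj₂ (bump-range r))))) o-range))
                    (<⇒>ᵇ≡true (s≤s (s≤s 1≤m)) ∷ [])
  bumped : All (λ v → 1 ≤ v × v ≢ 2) (map bump o)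
  bumped = All.map⁺ (All.map (λ r → let 1≤ , ≢2 , _ = bump-range r in 1≤ , ≢2) o-range)

containsᵇ-cycle-inflated : ∀ {c} → All (InRange m) c →
                           containsᵇ (1 ∷ (2 + m) ∷ map suc c) p213 ≡ containsᵇ c p213
containsᵇ-cycle-inflated {m} {c} c-range =
  trans (containsᵇ-∷-extreme {1} {s = 2} {1 ∷ 3 ∷ []} false minimal λ { (() ∷ _) })
  (trans (containsᵇ-∷-extreme {2 + m} {s = 2} {1 ∷ 3 ∷ []} true maximal λ { (_ ∷ () ∷ _) })
         (containsᵇ-map suc (λ _ _ → refl) c p213))
  where
  minimal : All (λ v → (1 >ᵇ v) ≡ false) ((2 + m) ∷ map suc c)
  minimal = refl ∷ All.map⁺ (All.universal (λ _ → refl) c)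
  maximal : All (λ v → ((2 + m) >ᵇ v) ≡ true) (map suc c)
  maximal = All.map⁺ (All.map (λ r → <⇒>ᵇ≡true (s≤s (s≤s (proj₂ r)))) c-range)

admissibleᵇ-inflated : ∀ {o c} → 1 ≤ m → All (InRange m) o → All (InRange m) c →
  admissibleᵇ ((2 + m) ∷ (map bump o ++ [ 2 ])) (1 ∷ (2 + m) ∷ map suc c) ≡ admissibleᵇ o c
admissibleᵇ-inflated {m} {o} {c} 1≤m o-range c-range
  rewrite distinctᵇ-oneLine-inflated 1≤m o-range
        | distinctᵇ-cycle-inflated c-range
        | containsᵇ-cycle-inflated c-range
  with distinctᵇ o in o-distinct
... | false = refl
... | true with o-unique ← distinctᵇ⇒Unique {o} (subst T (sym o-distinct) _)
  rewrite containsᵇ-oneLine-inflated {p₁ = 1} {3} {2} {4} 1≤m o-range o-unique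
                                     (s≤s z≤n) (s≤s z≤n) (s≤s (s≤s z≤n))
        | containsᵇ-oneLine-inflated {p₁ = 1} {4} {2} {3} 1≤m o-range o-unique
                                     (s≤s z≤n) (s≤s z≤n) (s≤s (s≤s z≤n))
        = refl

-- Inflating a permutation of [m] to one of [m + 2]

oneBased : Fin n → ℕ
oneBased i = suc (toℕ i)

oneBased-range : (l : List (Fin m)) → All (InRange m) (map oneBased l)
oneBased-range []      = []
oneBased-range (i ∷ l) = (s≤s z≤n , Fin.toℕ<n i) ∷ oneBased-range l

bumpFin : Fin m → Fin (2 + m)
bumpFin fzero    = fzero
bumpFin (fsuc y) = fsuc (fsuc (inject₁ y))

shift : Fin m → Fin (2 + m)
shift x = fsuc (inject₁ x)

inflate : Vec (Fin m) m → Vec (Fin (2 + m)) (2 + m)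
inflate {m} σ = fromℕ (suc m) ∷ᵛ (Vec.map bumpFin σ ∷ʳᵛ fsuc fzero)

oneBased-bumpFin : (y : Fin m) → oneBased (bumpFin y) ≡ bump (oneBased y)
oneBased-bumpFin fzero    = refl
oneBased-bumpFin (fsuc y) = cong (suc ∘ suc ∘ suc) (Fin.toℕ-inject₁ y)

oneBased-shift : (x : Fin m) → oneBased (shift x) ≡ suc (oneBased x)
oneBased-shift x = cong (suc ∘ suc) (Fin.toℕ-inject₁ x)

lookup-∷ʳ-inject₁ : (v : Vec A n) (y : A) (i : Fin n) → lookup (v ∷ʳᵛ y) (inject₁ i) ≡ lookup v i
lookup-∷ʳ-inject₁ (_ ∷ᵛ _) y fzero    = refl
lookup-∷ʳ-inject₁ (_ ∷ᵛ v) y (fsuc i) = lookup-∷ʳ-inject₁ v y i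

lookup-∷ʳ-fromℕ : (v : Vec A n) (y : A) → lookup (v ∷ʳᵛ y) (fromℕ n) ≡ y
lookup-∷ʳ-fromℕ []ᵛ      y = refl
lookup-∷ʳ-fromℕ (_ ∷ᵛ v) y = lookup-∷ʳ-fromℕ v y

lookup-inflate-shift : (σ : Vec (Fin m) m) (x : Fin m) →
                       lookup (inflate σ) (shift x) ≡ bumpFin (lookup σ x)
lookup-inflate-shift σ x = trans (lookup-∷ʳ-inject₁ (Vec.map bumpFin σ) _ x) (Vec.lookup-map x bumpFin σ)

oneLine-inflate : (σ : Vec (Fin m) m) → oneLine (inflate σ) ≡ (2 + m) ∷ (map bump (oneLine σ) ++ [ 2 ])
oneLine-inflate {m} σ = cong₂ _∷_ (cong suc (Fin.toℕ-fromℕ (suc m))) (begin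
  map oneBased (toList (σ̂ ∷ʳᵛ fsuc fzero))     ≡⟨ cong (map oneBased) (Vec.toList-∷ʳ _ σ̂) ⟩
  map oneBased (toList σ̂ ++ [ fsuc fzero ])   ≡⟨ map-++ oneBased (toList σ̂) _ ⟩
  map oneBased (toList σ̂) ++ [ 2 ]            ≡⟨ cong (λ l → map oneBased l ++ [ 2 ]) (Vec.toList-map bumpFin σ) ⟩
  map oneBased (map bumpFin (toList σ)) ++ [ 2 ] ≡⟨ cong (_++ [ 2 ]) (map-∘ (toList σ)) ⟨
  map (oneBased ∘ bumpFin) (toList σ) ++ [ 2 ]   ≡⟨ cong (_++ [ 2 ]) (map-cong oneBased-bumpFin (toList σ)) ⟩
  map (bump ∘ oneBased) (toList σ) ++ [ 2 ]      ≡⟨ cong (_++ [ 2 ]) (map-∘ (toList σ)) ⟩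
  map bump (oneLine σ) ++ [ 2 ]                  ∎)
  where
  open ≡-Reasoning
  σ̂ : Vec (Fin (2 + m)) m
  σ̂ = Vec.map bumpFin σ

one∉⇒fzero∉ : {l : List (Fin (suc n))} → All (1 ≢_) (map oneBased l) → All (_≢ fzero) l
one∉⇒fzero∉ one∉ = All.map (λ 1≢ y≡0 → 1≢ (cong oneBased (sym y≡0))) (All.map⁻ one∉)

module _ {k : ℕ} (σ : Vec (Fin (suc k)) (suc k)) where

  NoEarlyReturn : Set
  NoEarlyReturn = All (_≢ fzero) (orbit σ k (lookup σ fzero))

  orbit-inflate : ∀ j x → All (_≢ fzero) (orbit σ j (lookup σ x)) →
                  orbit (inflate σ) (suc j) (shift x) ≡ map shift (orbit σ (suc j) x)
  orbit-inflate zero    x _                  = refl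
  orbit-inflate (suc j) x (σx≢0 ∷ later≢0) = cong (shift x ∷_) (begin
    orbit (inflate σ) (suc j) (lookup (inflate σ) (shift x))  ≡⟨ cong (orbit (inflate σ) (suc j)) (step σx≢0) ⟩
    orbit (inflate σ) (suc j) (shift (lookup σ x))            ≡⟨ orbit-inflate j (lookup σ x) later≢0 ⟩
    map shift (orbit σ (suc j) (lookup σ x))                  ∎)
    where
    open ≡-Reasoning
    step : lookup σ x ≢ fzero → lookup (inflate σ) (shift x) ≡ shift (lookup σ x)
    step σx≢0 with lookup σ x | lookup-inflate-shift σ x
    ... | fzero  | _  = contradiction refl σx≢0
    ... | fsuc _ | eq = eq

  orbit-inflate⁻ : ∀ j x → All (_≢ fzero) (orbit (inflate σ) (suc j) (shift x)) →
                   All (_≢ fzero) (orbit σ j (lookup σ x))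
  orbit-inflate⁻ zero    x _                            = []
  orbit-inflate⁻ (suc j) x (_ ∷ later≢0@(next≢0 ∷ _)) with lookup σ x | lookup-inflate-shift σ x
  ... | fzero  | eq = contradiction eq next≢0
  ... | fsuc y | eq =
    (λ ()) ∷ orbit-inflate⁻ j (fsuc y) (subst (All (_≢ fzero) ∘ orbit (inflate σ) (suc j)) eq later≢0)

  cycleForm-inflate-raw :
    cycleForm (inflate σ) ≡ 1 ∷ (3 + k) ∷ map oneBased (orbit (inflate σ) (suc k) (shift fzero))
  cycleForm-inflate-raw = cong (1 ∷_) (cong₂ _∷_ (cong suc (Fin.toℕ-fromℕ (2 + k)))
    (cong (map oneBased ∘ orbit (inflate σ) (suc k)) (lookup-∷ʳ-fromℕ (Vec.map bumpFin σ) (fsuc fzero))))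

  cycleForm-inflate : NoEarlyReturn → cycleForm (inflate σ) ≡ 1 ∷ (3 + k) ∷ map suc (cycleForm σ)
  cycleForm-inflate no-return = trans cycleForm-inflate-raw (cong (λ c → 1 ∷ (3 + k) ∷ c) (begin
    map oneBased (orbit (inflate σ) (suc k) (shift fzero))
      ≡⟨ cong (map oneBased) (orbit-inflate k fzero no-return) ⟩
    map oneBased (map shift (orbit σ (suc k) fzero))        ≡⟨ map-∘ _ ⟨
    map (oneBased ∘ shift) (orbit σ (suc k) fzero)          ≡⟨ map-cong oneBased-shift _ ⟩
    map (suc ∘ oneBased) (orbit σ (suc k) fzero)            ≡⟨ map-∘ _ ⟩
    map suc (cycleForm σ)                                   ∎))
    where open ≡-Reasoning

  noEarlyReturn : Unique (cycleForm σ) → NoEarlyReturn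
  noEarlyReturn (one∉ ∷ _) = one∉⇒fzero∉ one∉

  noEarlyReturn-inflate : Unique (cycleForm (inflate σ)) → NoEarlyReturn
  noEarlyReturn-inflate unique with (_ ∷ one∉) ∷ _ ← subst Unique cycleForm-inflate-raw unique =
    orbit-inflate⁻ k fzero (one∉⇒fzero∉ one∉)

  inARestr-inflate : NoEarlyReturn → inARestrᵇ 3 (inflate σ) ≡ inAᵇ σ
  inARestr-inflate no-return = begin
    inARestrᵇ 3 (inflate σ)
      ≡⟨ cong₂ (λ o c → admissibleᵇ o c ∧ entryIsᵇ 3 2 c) (oneLine-inflate σ) (cycleForm-inflate no-return) ⟩
    admissibleᵇ ((3 + k) ∷ (map bump (oneLine σ) ++ [ 2 ])) (1 ∷ (3 + k) ∷ map suc (cycleForm σ)) ∧ true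
      ≡⟨ ∧-identityʳ _ ⟩
    admissibleᵇ ((3 + k) ∷ (map bump (oneLine σ) ++ [ 2 ])) (1 ∷ (3 + k) ∷ map suc (cycleForm σ))
      ≡⟨ admissibleᵇ-inflated (s≤s z≤n) (oneBased-range (toList σ))
                                        (oneBased-range (orbit σ (suc k) fzero)) ⟩
    inAᵇ σ ∎
    where open ≡-Reasoning

bumpFin-injective : Injective _≡_ _≡_ (bumpFin {m})
bumpFin-injective {x = fzero}  {fzero}  _  = refl
bumpFin-injective {x = fsuc x} {fsuc y} eq =
  cong fsuc (Fin.inject₁-injective (Fin.suc-injective (Fin.suc-injective eq)))

map-injective : ∀ {B : Set} {f : A → B} → Injective _≡_ _≡_ f → Injective _≡_ _≡_ (Vec.map {n = n} f)
map-injective f-inj {[]ᵛ}     {[]ᵛ}     _  = refl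
map-injective f-inj {x ∷ᵛ xs} {y ∷ᵛ ys} eq =
  cong₂ _∷ᵛ_ (f-inj (Vec.∷-injectiveˡ eq)) (map-injective f-inj (Vec.∷-injectiveʳ eq))

inflate-injective : Injective _≡_ _≡_ (inflate {m})
inflate-injective eq = map-injective bumpFin-injective (Vec.∷ʳ-injectiveˡ _ _ (Vec.∷-injectiveʳ eq))

-- The image of inflate

length-orbit : (π : Vec (Fin n) n) → ∀ j x → length (orbit π j x) ≡ j
length-orbit π zero    x = refl
length-orbit π (suc j) x = cong suc (length-orbit π j (lookup π x))

2<oneBased : {x : Fin (2 + n)} → x ≢ fzero → x ≢ fsuc fzero → 2 < oneBased x
2<oneBased {x = fzero}         x≢0 _   = contradiction refl x≢0
2<oneBased {x = fsuc fzero}    _   x≢1 = contradiction refl x≢1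
2<oneBased {x = fsuc (fsuc _)} _   _   = s≤s (s≤s (s≤s z≤n))

first-entry-max : (π : Vec (Fin (3 + k)) (3 + k)) → Unique (cycleForm π) → T (avoidsᵇ (cycleForm π) p213) →
                  lookup π (lookup π fzero) ≡ fsuc fzero → lookup π fzero ≡ fromℕ (2 + k)
first-entry-max {k} π unique avoids πx≡1 =
  locate (unique∧length≡n⇒∈ orbit-unique (length-orbit π (3 + k) fzero) (fromℕ (2 + k)))
  where
  x : Fin (3 + k)
  x = lookup π fzero
  orbit-unique : Unique (orbit π (3 + k) fzero)
  orbit-unique = Unique.map⁻ unique
  locate : fromℕ (2 + k) ∈ orbit π (3 + k) fzero → x ≡ fromℕ (2 + k)
  locate (there (here max≡x))              = sym max≡x
  locate (there (there (here max≡πx)))     = contradiction (Fin.suc-injective (trans max≡πx πx≡1)) λ ()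
  locate (there (there (there max∈later))) with (x≢0 ∷ _) ∷ (x≢πx ∷ x∉later) ∷ _ ← orbit-unique =
    contradiction (occurrence-213 2<x x<max x,2,max⊆cycle) (T-not⇒¬T avoids)
    where
    x,2,max⊆cycle : oneBased x ∷ 2 ∷ oneBased (fromℕ (2 + k)) ∷ [] ⊆ cycleForm π
    x,2,max⊆cycle = 1 ∷ʳ refl ∷ cong oneBased (sym πx≡1) ∷ from∈ (∈-map⁺ oneBased max∈later)
    2<x : 2 < oneBased x
    2<x = 2<oneBased (x≢0 ∘ sym) (λ x≡1 → x≢πx (trans x≡1 (sym πx≡1)))
    x<max : oneBased x < oneBased (fromℕ (2 + k))
    x<max = s≤s (Fin.≤∧≢⇒< (Fin.≤fromℕ x) (All.lookup x∉later max∈later))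

bumpFin-preimage : (e : Fin (3 + k)) → e ≢ fromℕ (2 + k) → e ≢ fsuc fzero → ∃[ d ] bumpFin d ≡ e
bumpFin-preimage fzero               _     _   = fzero , refl
bumpFin-preimage (fsuc fzero)        _     e≢1 = contradiction refl e≢1
bumpFin-preimage {k} (fsuc (fsuc z)) e≢max _   =
  fsuc (lower₁ z k≢z) , cong (fsuc ∘ fsuc) (Fin.inject₁-lower₁ z k≢z)
  where
  k≢z : k ≢ toℕ z
  k≢z k≡z = e≢max (cong (fsuc ∘ fsuc) (Fin.toℕ-injective (trans (sym k≡z) (sym (Fin.toℕ-fromℕ k)))))

map-bumpFin-preimage : (v : Vec (Fin (3 + k)) n) → All (λ e → e ≢ fromℕ (2 + k) × e ≢ fsuc fzero) (toList v) →
                       ∃[ w ] Vec.map bumpFin w ≡ v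
map-bumpFin-preimage []ᵛ      []                    = []ᵛ , refl
map-bumpFin-preimage (e ∷ᵛ v) ((e≢max , e≢1) ∷ rest) =
  let d , d-eq = bumpFin-preimage e e≢max e≢1 ; w , w-eq = map-bumpFin-preimage v rest
  in d ∷ᵛ w , cong₂ _∷ᵛ_ d-eq w-eq

unique-++[]⁻ : {l : List A} {y : A} → Unique (l ++ [ y ]) → All (_≢ y) l
unique-++[]⁻ {l = []}    _             = []
unique-++[]⁻ {l = x ∷ l} (x∉ ∷ unique) = All.head (All.++⁻ʳ l x∉) ∷ unique-++[]⁻ unique

inA⁻ : {π : Vec (Fin n) n} → T (inAᵇ π) →
       Unique (oneLine π) × Unique (cycleForm π) × T (avoidsᵇ (cycleForm π) p213)
inA⁻ {π = π} t =
  let cyclic , avoids       = Equivalence.to (T-∧ {isCyclicᵇ π}) t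
      distinctO , distinctC = Equivalence.to (T-∧ {distinctᵇ (oneLine π)} {distinctᵇ (cycleForm π)}) cyclic
      _ , avoids'           = Equivalence.to (T-∧ {avoidsᵇ (oneLine π) p1324}) avoids
      _ , avoids213         = Equivalence.to (T-∧ {avoidsᵇ (oneLine π) p1423} {avoidsᵇ (cycleForm π) p213}) avoids'
  in distinctᵇ⇒Unique distinctO , distinctᵇ⇒Unique distinctC , avoids213

inARestr⁻ : ∀ {j} {π : Vec (Fin n) n} → T (inARestrᵇ j π) → T (inAᵇ π) × T (entryIsᵇ j 2 (cycleForm π))
inARestr⁻ {j = j} {π} = Equivalence.to (T-∧ {inAᵇ π} {entryIsᵇ j 2 (cycleForm π)})

inARestr⇒inflated : (π : Vec (Fin (3 + k)) (3 + k)) → T (inARestrᵇ 3 π) → ∃[ σ ] π ≡ inflate σ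
inARestr⇒inflated {k} (x ∷ᵛ π') t with Vec.initLast π'
... | v , y , refl with inARestr⁻ {j = 3} {π = x ∷ᵛ (v ∷ʳᵛ y)} t
... | inA , c₃≡2 with oneLine-unique , cycle-unique , avoids ← inA⁻ inA =
  proj₁ preimage , cong₂ _∷ᵛ_ x≡max (cong₂ _∷ʳᵛ_ (sym (proj₂ preimage)) y≡1)
  where
  π : Vec (Fin (3 + k)) (3 + k)
  π = x ∷ᵛ (v ∷ʳᵛ y)
  πx≡1 : lookup π x ≡ fsuc fzero
  πx≡1 = Fin.toℕ-injective (ℕ.suc-injective (ℕ.≡ᵇ⇒≡ _ 2 c₃≡2))
  x≡max : x ≡ fromℕ (2 + k)
  x≡max = first-entry-max π cycle-unique avoids πx≡1
  y≡1 : y ≡ fsuc fzero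
  y≡1 = trans (sym (lookup-∷ʳ-fromℕ v y)) (subst (λ z → lookup π z ≡ fsuc fzero) x≡max πx≡1)
  middle : All (λ e → e ≢ fromℕ (2 + k) × e ≢ fsuc fzero) (toList v)
  middle with x∉ ∷ rest ← subst Unique (cong (x ∷_) (Vec.toList-∷ʳ y v)) (Unique.map⁻ oneLine-unique) =
    All.zipWith (λ (x≢e , e≢y) → (λ e≡max → x≢e (trans x≡max (sym e≡max))) ,
                                 (λ e≡1 → e≢y (trans e≡1 (sym y≡1))))
                (All.++⁻ˡ (toList v) x∉ , unique-++[]⁻ rest)
  preimage : ∃[ w ] Vec.map bumpFin w ≡ v
  preimage = map-bumpFin-preimage v middle

T-inA⇔T-inARestr-inflate : (σ : Vec (Fin (suc k)) (suc k)) → T (inAᵇ σ) ⇔ T (inARestrᵇ 3 (inflate σ))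
T-inA⇔T-inARestr-inflate σ = mk⇔ (λ t → subst T (sym (inARestr-inflate σ (late t))) t)
                                  (λ t → subst T (inARestr-inflate σ (late-inflated t)) t)
  where
  late : T (inAᵇ σ) → NoEarlyReturn σ
  late t = noEarlyReturn σ (proj₁ (proj₂ (inA⁻ t)))
  late-inflated : T (inARestrᵇ 3 (inflate σ)) → NoEarlyReturn σ
  late-inflated t = noEarlyReturn-inflate σ (proj₁ (proj₂ (inA⁻ (proj₁ (inARestr⁻ {j = 3} {π = inflate σ} t)))))

aRestr-3≡a : ∀ k → aRestr (3 + k) 3 ≡ a (suc k)
aRestr-3≡a k = trans
  (unique∧set⇒length≡ (Unique.filter⁺ P? (allVecs-unique (3 + k) (3 + k)))
                      (Unique.map⁺ inflate-injective (Unique.filter⁺ Q? (allVecs-unique (suc k) (suc k))))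
                      (mk⇔ to from))
  (length-map inflate (filter Q? (allVecs (suc k) (suc k))))
  where
  P? : (π : Vec (Fin (3 + k)) (3 + k)) → Dec (T (inARestrᵇ 3 π))
  P? π = T? (inARestrᵇ 3 π)
  Q? : (σ : Vec (Fin (suc k)) (suc k)) → Dec (T (inAᵇ σ))
  Q? σ = T? (inAᵇ σ)
  to : ∀ {π} → π ∈ filter P? (allVecs (3 + k) (3 + k)) → π ∈ map inflate (filter Q? (allVecs (suc k) (suc k)))
  to {π} π∈ with _ , t ← ∈-filter⁻ P? {xs = allVecs (3 + k) (3 + k)} π∈
            with σ , refl ← inARestr⇒inflated {k} π t =
    ∈-map⁺ inflate (∈-filter⁺ Q? (∈-allVecs σ) (Equivalence.from (T-inA⇔T-inARestr-inflate σ) t))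
  from : ∀ {π} → π ∈ map inflate (filter Q? (allVecs (suc k) (suc k))) → π ∈ filter P? (allVecs (3 + k) (3 + k))
  from π∈ with σ , σ∈ , refl ← ∈-map⁻ inflate π∈
          with _ , t ← ∈-filter⁻ Q? {xs = allVecs (suc k) (suc k)} σ∈ =
    ∈-filter⁺ P? (∈-allVecs _) (Equivalence.to (T-inA⇔T-inARestr-inflate σ) t)

lemma4p3 : (n : ℕ) → 6 ≤ n → aRestr n 3 ≡ a (n ∸ 2)
lemma4p3 (suc (suc (suc k))) _              = aRestr-3≡a k
lemma4p3 (suc zero)          (s≤s ())
lemma4p3 (suc (suc zero))    (s≤s (s≤s ()))
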